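{- Let $c\geq1$ be an integer, $H=(V,E)$ a hypergraph and $\gamma\colon E\to[0,1]$. Let $(\mathbf{S},U)$ be a well-formed pair with respect to $\gamma$ such that $\mathbf{S}\neq\emptyset$ and every element of $\mathbf{S}$ has size at most $c-1$. Let $S\in\mathbf{S}$ and let $T\subseteq E$ be any set of edges. Let $L=(\bigcap S\cap B(\gamma))\setminus\bigcup T$, $\mathbf{S}'=(\mathbf{S}\setminus\{S\})\cup\{S\cup\{e\}\mid e\in T\}$ and $U'=U\cup L$. Then $(\mathbf{S}',U')$ is a well-formed pair with respect to $\gamma$.
   Context: A hypergraph $H=(V,E)$ has a finite vertex set $V$ and a set $E$ of non-empty subsets of $V$. For $\gamma\colon E\to[0,1]$, $B(\gamma)=\{v\in V\mid\sum_{e\ni v}\gamma(e)\geq 1\}$. For a set $S$ of edges, $\bigcap S$ is the set of vertices lying in all edges of $S$ and $\bigcup T$ the set of vertices lying in some edge of $T$. A pair $(\mathbf{S},U)$ is well-formed (with respect to $\gamma$ and $c$) if (1) $U\subseteq B(\gamma)$, (2) $\mathbf{S}=\{S_1,\dots,S_r\}$ is a finite collection where each $S_i$ is a set of at most $c$ edges of $H$, and (3) $B(\gamma)\setminus U\subseteq\bigcup_{i\in[r]}\bigcap S_i$.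
   Formalization: The function γ takes only rational values in $[0,1]$. -}

module Defs where

open import Data.Nat using (ℕ; _≤_; _∸_)
open import Data.Fin using (Fin)
open import Data.Fin.Subset using (Subset; _∈_; _∉_; ∣_∣; _∪_; ⁅_⁆)
open import Data.Rational using (ℚ; 0ℚ; 1ℚ; _+_) renaming (_≤_ to _≤ℚ_)
open import Data.Product using (Σ; ∃; _×_)
open import Data.Sum using (_⊎_)
open import Data.Empty using (⊥)
open import Relation.Nullary using (¬_; yes; no)
open import Relation.Binary.PropositionalEquality using (_≡_; _≢_)
open import Data.Vec.Functional using (foldr)
open import Data.Fin.Subset.Properties using (_∈?_)

record Hypergraph (n m : ℕ) : Set where
  field
    edge      : Fin m → Subset n
    nonempty  : ∀ e → ∃ λ v → v ∈ edge e
    distinct  : ∀ e f → edge e ≡ edge f → e ≡ f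
open Hypergraph public

IsWeighting : ∀ {m} → (Fin m → ℚ) → Set
IsWeighting γ = ∀ e → (0ℚ ≤ℚ γ e) × (γ e ≤ℚ 1ℚ)

load : ∀ {n m} → Hypergraph n m → (Fin m → ℚ) → Fin n → ℚ
load H γ v = foldr _+_ 0ℚ (λ e → contrib e)
  where
  contrib : _ → ℚ
  contrib e with v ∈? edge H e
  ... | yes _ = γ e
  ... | no  _ = 0ℚ

B : ∀ {n m} → Hypergraph n m → (Fin m → ℚ) → Fin n → Set
B H γ v = 1ℚ ≤ℚ load H γ v

⋂ : ∀ {n m} → Hypergraph n m → Subset m → Fin n → Set
⋂ H S v = ∀ e → e ∈ S → v ∈ edge H e

⋃ : ∀ {n m} → Hypergraph n m → Subset m → Fin n → Set
⋃ H T v = ∃ λ e → e ∈ T × v ∈ edge H e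

-- A collection 𝐒 of sets of edges is a predicate on Subset m (automatically finite).
-- Sets of vertices U are predicates on Fin n.
WellFormed : ∀ {n m} → Hypergraph n m → (Fin m → ℚ) → ℕ →
             (Subset m → Set) → (Fin n → Set) → Set
WellFormed H γ c 𝐒 U =
  (∀ v → U v → B H γ v) ×
  (∀ S → 𝐒 S → ∣ S ∣ ≤ c) ×
  (∀ v → B H γ v → ¬ U v → ∃ λ S → 𝐒 S × ⋂ H S v)

Lset : ∀ {n m} → Hypergraph n m → (Fin m → ℚ) → Subset m → Subset m → Fin n → Set
Lset H γ S T v = ⋂ H S v × B H γ v × ¬ ⋃ H T v

newCollection : ∀ {m} → (Subset m → Set) → Subset m → Subset m → Subset m → Set
newCollection 𝐒 S T X = (𝐒 X × X ≢ S) ⊎ (∃ λ e → e ∈ T × X ≡ S ∪ ⁅ e ⁆)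

newU : ∀ {n m} → Hypergraph n m → (Fin m → ℚ) → (Fin n → Set) → Subset m → Subset m → Fin n → Set
newU H γ U S T v = U v ⊎ Lset H γ S T v

-- Only the covering condition needs thought.  A vertex of B(γ) outside U' is, by
-- well-formedness of (𝐒, U), in ⋂ S' for some S' ∈ 𝐒; if S' ≠ S then S' ∈ 𝐒' still
-- covers it.  If S' = S, the vertex is not in L, so it lies in ⋃ T (membership in ⋃ T
-- is decidable, so this needs no classical logic), i.e. in some
-- edge e ∈ T, and then it lies in ⋂ (S ∪ {e}) with S ∪ {e} ∈ 𝐒'.  Sizes stay at most c
-- because the new sets add one edge to a set of size at most c - 1.
module Submission where

open import Defs
open import Data.Bool using () renaming (_≟_ to _≟ᵇ_)
open import Data.Fin using (Fin)
open import Data.Fin.Properties using (any?)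
open import Data.Fin.Subset using (Subset; _∈_; ∣_∣; _∪_; ⁅_⁆; inside; outside)
open import Data.Fin.Subset.Properties using (_∈?_; x∈p∪q⁻; x∈⁅y⁆⇒x≡y; ∣⁅x⁆∣≡1)
open import Data.Nat using (ℕ; _≤_; _∸_; _+_; suc; z≤n; s≤s)
open import Data.Nat.Properties using (≤-trans; n≤1+n; +-monoʳ-≤; +-suc; m≤o∸n⇒m+n≤o; module ≤-Reasoning)
open import Data.Product using (∃; _×_; _,_)
open import Data.Rational using (ℚ)
open import Data.Sum using (inj₁; inj₂)
open import Data.Vec using (_∷_; [])
open import Data.Vec.Properties using (≡-dec)
open import Relation.Nullary using (Dec; yes; no; ¬_)
open import Relation.Nullary.Decidable using (_×-dec_; decidable-stable)
open import Relation.Binary.PropositionalEquality using (refl; cong)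

∣p∪q∣≤∣p∣+∣q∣ : ∀ {k} (p q : Subset k) → ∣ p ∪ q ∣ ≤ ∣ p ∣ + ∣ q ∣
∣p∪q∣≤∣p∣+∣q∣ []            []            = z≤n
∣p∪q∣≤∣p∣+∣q∣ (inside  ∷ p) (inside  ∷ q) = s≤s (≤-trans (∣p∪q∣≤∣p∣+∣q∣ p q) (+-monoʳ-≤ ∣ p ∣ (n≤1+n ∣ q ∣)))
∣p∪q∣≤∣p∣+∣q∣ (inside  ∷ p) (outside ∷ q) = s≤s (∣p∪q∣≤∣p∣+∣q∣ p q)
∣p∪q∣≤∣p∣+∣q∣ (outside ∷ p) (inside  ∷ q) rewrite +-suc ∣ p ∣ ∣ q ∣ = s≤s (∣p∪q∣≤∣p∣+∣q∣ p q)
∣p∪q∣≤∣p∣+∣q∣ (outside ∷ p) (outside ∷ q) = ∣p∪q∣≤∣p∣+∣q∣ p q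

∣p∪⁅x⁆∣≤∣p∣+1 : ∀ {k} (p : Subset k) (x : Fin k) → ∣ p ∪ ⁅ x ⁆ ∣ ≤ ∣ p ∣ + 1
∣p∪⁅x⁆∣≤∣p∣+1 p x = begin
  ∣ p ∪ ⁅ x ⁆ ∣     ≤⟨ ∣p∪q∣≤∣p∣+∣q∣ p ⁅ x ⁆ ⟩
  ∣ p ∣ + ∣ ⁅ x ⁆ ∣ ≡⟨ cong (∣ p ∣ +_) (∣⁅x⁆∣≡1 x) ⟩
  ∣ p ∣ + 1         ∎
  where open ≤-Reasoning

module _ {n m : ℕ} (H : Hypergraph n m) where

  ⋃? : (T : Subset m) (v : Fin n) → Dec (⋃ H T v)
  ⋃? T v = any? (λ e → (e ∈? T) ×-dec (v ∈? edge H e))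

  ⋂-∪⁅⁆ : ∀ {S v} e → ⋂ H S v → v ∈ edge H e → ⋂ H (S ∪ ⁅ e ⁆) v
  ⋂-∪⁅⁆ {S} e v∈⋂S v∈e f f∈S∪e with x∈p∪q⁻ S ⁅ e ⁆ f∈S∪e
  ... | inj₁ f∈S = v∈⋂S f f∈S
  ... | inj₂ f∈e with x∈⁅y⁆⇒x≡y e f∈e
  ...   | refl = v∈e

  module _ (γ : Fin m → ℚ) (𝐒 : Subset m → Set) (U : Fin n → Set) (S T : Subset m) where

    newU⊆B : (∀ v → U v → B H γ v) → ∀ v → newU H γ U S T v → B H γ v
    newU⊆B U⊆B v (inj₁ v∈U)           = U⊆B v v∈U
    newU⊆B U⊆B v (inj₂ (_ , v∈B , _)) = v∈B

    newCollection-bounded : ∀ {c} → (∀ X → 𝐒 X → ∣ X ∣ ≤ c) → ∣ S ∣ + 1 ≤ c →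
                            ∀ X → newCollection 𝐒 S T X → ∣ X ∣ ≤ c
    newCollection-bounded 𝐒-bounded _   X (inj₁ (X∈𝐒 , _))     = 𝐒-bounded X X∈𝐒
    newCollection-bounded _ ∣S∣+1≤c _ (inj₂ (e , _ , refl)) = ≤-trans (∣p∪⁅x⁆∣≤∣p∣+1 S e) ∣S∣+1≤c

    newCollection-covers : (∀ v → B H γ v → ¬ U v → ∃ λ X → 𝐒 X × ⋂ H X v) →
                           ∀ v → B H γ v → ¬ newU H γ U S T v →
                           ∃ λ X → newCollection 𝐒 S T X × ⋂ H X v
    newCollection-covers covers v v∈B v∉U' with covers v v∈B (λ v∈U → v∉U' (inj₁ v∈U))
    ... | X , X∈𝐒 , v∈⋂X with ≡-dec _≟ᵇ_ X S
    ...   | no X≢S = X , inj₁ (X∈𝐒 , X≢S) , v∈⋂X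
    ...   | yes refl with decidable-stable (⋃? T v) (λ v∉⋃T → v∉U' (inj₂ (v∈⋂X , v∈B , v∉⋃T)))
    ...     | e , e∈T , v∈e = X ∪ ⁅ e ⁆ , inj₂ (e , e∈T , refl) , ⋂-∪⁅⁆ e v∈⋂X v∈e

proposition3p8 : (c : ℕ) → 1 ≤ c → {n m : ℕ} → (H : Hypergraph n m) → (γ : Fin m → ℚ) →
    IsWeighting γ → (𝐒 : Subset m → Set) → (U : Fin n → Set) →
    WellFormed H γ c 𝐒 U → (∃ λ S₀ → 𝐒 S₀) → (∀ X → 𝐒 X → ∣ X ∣ ≤ c ∸ 1) →
    (S : Subset m) → 𝐒 S → (T : Subset m) →
    WellFormed H γ c (newCollection 𝐒 S T) (newU H γ U S T)
proposition3p8 c 1≤c H γ _ 𝐒 U (U⊆B , 𝐒-bounded , covers) _ small S S∈𝐒 T =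
    newU⊆B H γ 𝐒 U S T U⊆B
  , newCollection-bounded H γ 𝐒 U S T 𝐒-bounded (m≤o∸n⇒m+n≤o ∣ S ∣ 1≤c (small S S∈𝐒))
  , newCollection-covers H γ 𝐒 U S T covers
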